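{- For every integer $n \geq 1$ and every $w \in \{0,1\}^n$, $\mathrm{occ}_b(w, S_n) = 1$; that is, when $S_n$ is cut into consecutive blocks of length $n$, each binary string of length $n$ appears exactly once among these blocks. (Here $S_n$ is the string defined in the context.)
   Context: Strings are binary and indexed from $0$; $x[i..j]$ denotes bits $i$ through $j$ of $x$ (empty if $j<i$), and $x^t$ is $x$ concatenated with itself $t$ times. For a string $x$ and $w$ with $|w|=n\ge 1$, $\mathrm{occ}_b(w,x)$ is the number of indices $i$ with $i \equiv 0 \pmod{n}$ and $x[i..i+n-1] = w$. For $n \geq 1$, $db(n)$ denotes the lexicographically least de Bruijn string of order $n$ (length $2^n$; viewed cyclically it contains every binary string of length $n$ exactly once as a substring), obtained as follows: start with $x = 1^{n-1}$; while possible, append a bit to $x$ (preferring $0$ over $1$) such that every substring of length $n$ of $x$ occurs only once in $x$; when no bit can be appended, delete the prefix $1^{n-1}$. For $0 \le i < 2^n$, $db_i(n) = db(n)[i..2^n-1]\, db(n)[0..i-1]$ is the left cyclic shift by $i$, and $db_i^t(n)$ is $db_i(n)$ concatenated $t$ times. For $n \ge 1$ write $n = 2^s t$ with $s \ge 0$ and $t$ odd, and set $S_n = db_0^t(n)\, db_1^t(n) \cdots db_{2^s-1}^t(n)$. -}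

module Defs where

open import Data.Bool using (Bool; true; false; if_then_else_)
open import Data.Nat using (ℕ; zero; suc; _+_; _*_; _∸_; _^_; _≤?_; _≡ᵇ_; _/_; _%_)
open import Data.List using (List; []; _∷_; _++_; [_]; take; drop; length; replicate; upTo; concat; map; filter)
open import Data.List.Properties using (≡-dec)
open import Data.Product using (_×_; _,_; proj₁; proj₂)
open import Relation.Nullary using (yes; no; _×-dec_)
open import Relation.Binary.PropositionalEquality using (_≡_)
import Data.Bool.Properties as BoolP
import Data.List.Relation.Unary.Unique.DecPropositional as UniqueDec

-- Binary strings are lists of booleans (false = 0, true = 1).
Bits : Set
Bits = List Bool

_≟bits_ : (x y : Bits) → Relation.Nullary.Dec (x ≡ y)
_≟bits_ = ≡-dec BoolP._≟_

open UniqueDec _≟bits_ using (Unique; unique?)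

sub : Bits → ℕ → ℕ → Bits
sub x i n = take n (drop i x)

windows : ℕ → Bits → List Bits
windows n x with length x Data.Nat.<ᵇ n
... | true  = []
... | false = map (λ i → sub x i n) (upTo (suc (length x ∸ n)))

-- Fuel: each successful append adds a new distinct window, so at most 2^n appends
-- can ever succeed; fuel 2^n + 1 therefore never truncates the process.
greedy : ℕ → ℕ → Bits → Bits
greedy n zero    x = x
greedy n (suc f) x with unique? (windows n (x ++ [ false ]))
... | yes _ = greedy n f (x ++ [ false ])
... | no  _ with unique? (windows n (x ++ [ true ]))
...   | yes _ = greedy n f (x ++ [ true ])
...   | no  _ = x

db : ℕ → Bits
db n = drop (n ∸ 1) (greedy n (2 ^ n + 1) (replicate (n ∸ 1) true))

dbShift : ℕ → ℕ → Bits
dbShift n i = drop i (db n) ++ take i (db n)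

pow : Bits → ℕ → Bits
pow x zero    = []
pow x (suc t) = x ++ pow x t

-- 2-adic decomposition n = 2^s * t with t odd (for n ≥ 1); returns (s , t).
-- The first argument is fuel (n suffices since each step halves n).
split2 : ℕ → ℕ → ℕ × ℕ
split2 zero    m = (0 , m)
split2 (suc f) m with m ≡ᵇ 0 | m % 2 ≡ᵇ 0
... | false | true  = let r = split2 f (m / 2) in (suc (proj₁ r) , proj₂ r)
... | _     | _     = (0 , m)

val2 : ℕ → ℕ
val2 n = proj₁ (split2 n n)

oddPart : ℕ → ℕ
oddPart n = proj₂ (split2 n n)

S : ℕ → Bits
S n = concat (map (λ i → pow (dbShift n i) (oddPart n)) (upTo (2 ^ val2 n)))

occb : Bits → Bits → ℕ
-- (|w| ≥ 1 is assumed; suc (|w| ∸ 1) is |w| then.)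
occb w x = length (filter (λ i → ((i % suc (length w ∸ 1)) Data.Nat.≟ 0) ×-dec ((i + length w) ≤? length x) ×-dec (sub x i (length w) ≟bits w)) (upTo (length x)))

{-# OPTIONS --safe #-}
-- The greedy construction of db(n) yields y = 1^(n-1) db(n) in which every length-n window occurs
-- at most once.  Since 1 is appended only after 0 failed, and the last n - 1 bits of y must again be
-- 1^(n-1) (otherwise the last node would be entered by three distinct windows), walking backwards from
-- 1^(n-1) shows that every length-n word occurs in y; so db(n) is de Bruijn and y reads it cyclically.
-- Write n = 2^s t with t odd and 2^n = 2^s M.  The κ-th length-n block of S_n is the cyclic window of
-- db(n) at offset κ / M + κ n, whose residue mod 2^n has radix-2^s digits κ / M and (κ mod M) t mod M.
-- As t is odd this is a bijection on residues, so every window is exactly one block.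
module Submission where

open import Defs
open import Data.Nat using (ℕ; _≥_)
open import Data.List using (length)
open import Relation.Binary.PropositionalEquality using (_≡_)

open import Data.Bool using (Bool; true; false; T; if_then_else_)
open import Data.Bool.Properties using (¬-not) renaming (_≟_ to _≟𝔹_)
open import Data.Nat
  using (zero; suc; pred; _+_; _*_; _∸_; _^_; _⊓_; _≤_; _≰_; _<_; _/_; _%_; z≤n; s≤s;
         NonZero; >-nonZero; ≢-nonZero; _≟_; _<?_; _<ᵇ_; _≡ᵇ_)
open import Data.Nat.Properties
open import Data.Nat.DivMod
open import Data.Nat.Divisibility
  using (_∣_; divides; 1∣_; ∣m+n∣m⇒∣n; n∣m*n; m∣m*n; ∣-trans; *-cancelˡ-∣; *-monoʳ-∣; n∣m⇒m%n≡0)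
open import Data.Nat.Solver using (module +-*-Solver)
open +-*-Solver using (solve; _:=_; _:+_; _:*_)
open import Data.List using ([]; _∷_; initLast; _∷ʳ′_; _++_; [_]; take; drop; replicate; upTo; concat; filter; applyUpTo)
open import Data.List.Properties
  using (∷ʳ-injective; ∷ʳ-injectiveˡ; ∷ʳ-injectiveʳ; ++-assoc; ++-identityʳ; take-all; length-++; length-take; length-drop;
         length-replicate; map-upTo; upTo-∷ʳ; filter-++; filter-accept; filter-reject)
open import Data.List.Relation.Unary.AllPairs using (_∷_)
import Data.List.Relation.Unary.All as All
open import Data.List.Membership.Propositional.Properties using (∈-applyUpTo⁺)
import Data.List.Relation.Unary.Unique.Propositional.Properties as Unique
open import Data.List.Relation.Unary.Unique.DecPropositional _≟bits_ using (Unique; unique?)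
import Data.Fin as Fin
import Data.Fin.Properties as Fin
open import Data.Product using (_×_; _,_; proj₁; proj₂; ∃)
open import Data.Sum using (_⊎_; inj₁; inj₂)
open import Data.Empty using (⊥; ⊥-elim)
open import Data.Unit using (tt)
open import Relation.Nullary using (¬_; Dec; yes; no; contradiction)
open import Relation.Binary.PropositionalEquality using (_≢_; refl; sym; trans; cong; cong₂; subst; subst₂; module ≡-Reasoning)
open import Function using (_∘_)

-- Positions past the end read as false; all uses below are in range.
at : Bits → ℕ → Bool
at []      _       = false
at (b ∷ x) zero    = b
at (b ∷ x) (suc i) = at x i

at-drop : ∀ x i r → at (drop i x) r ≡ at x (i + r)
at-drop []      zero    r = refl
at-drop []      (suc i) r = refl
at-drop (b ∷ x) zero    r = refl
at-drop (b ∷ x) (suc i) r = at-drop x i r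

at-take : ∀ x n r → r < n → at (take n x) r ≡ at x r
at-take []      zero    r       _       = refl
at-take []      (suc n) r       _       = refl
at-take (b ∷ x) (suc n) zero    _       = refl
at-take (b ∷ x) (suc n) (suc r) (s≤s p) = at-take x n r p

at-sub : ∀ x i n r → r < n → at (sub x i n) r ≡ at x (i + r)
at-sub x i n r r<n = trans (at-take (drop i x) n r r<n) (at-drop x i r)

at-++ˡ : ∀ x y i → i < length x → at (x ++ y) i ≡ at x i
at-++ˡ (b ∷ x) y zero    _       = refl
at-++ˡ (b ∷ x) y (suc i) (s≤s p) = at-++ˡ x y i p

at-++ʳ : ∀ x y i → at (x ++ y) (length x + i) ≡ at y i
at-++ʳ []      y i = refl
at-++ʳ (b ∷ x) y i = at-++ʳ x y i

at-replicate : ∀ k (b : Bool) i → i < k → at (replicate k b) i ≡ b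
at-replicate (suc k) b zero    _       = refl
at-replicate (suc k) b (suc i) (s≤s p) = at-replicate k b i p

at-ext : ∀ x y → length x ≡ length y → (∀ i → i < length x → at x i ≡ at y i) → x ≡ y
at-ext []      []      _ _ = refl
at-ext (a ∷ x) (b ∷ y) e f = cong₂ _∷_ (f 0 (s≤s z≤n)) (at-ext x y (suc-injective e) (λ i p → f (suc i) (s≤s p)))

at-++-split : ∀ x y i → i < length x + length y →
              (i < length x × at (x ++ y) i ≡ at x i) ⊎ ∃ λ j → j < length y × i ≡ length x + j × at (x ++ y) i ≡ at y j
at-++-split x y i lt with i <? length x
... | yes i<x = inj₁ (i<x , at-++ˡ x y i i<x)
... | no i≮x = inj₂ (i ∸ length x , +-cancelˡ-< (length x) _ _ (subst (_< length x + length y) (sym i≡) lt) , sym i≡ ,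
                     trans (cong (at (x ++ y)) (sym i≡)) (at-++ʳ x y (i ∸ length x)))
  where
  i≡ : length x + (i ∸ length x) ≡ i
  i≡ = m+[n∸m]≡n (≮⇒≥ i≮x)

length-sub : ∀ x i n → i + n ≤ length x → length (sub x i n) ≡ n
length-sub x i n i+n≤ = begin
  length (take n (drop i x)) ≡⟨ length-take n (drop i x) ⟩
  n ⊓ length (drop i x)      ≡⟨ cong (n ⊓_) (length-drop i x) ⟩
  n ⊓ (length x ∸ i)         ≡⟨ m≤n⇒m⊓n≡m (m+n≤o⇒m≤o∸n n (subst (_≤ length x) (+-comm i n) i+n≤)) ⟩
  n ∎
  where open ≡-Reasoning

windows≡applyUpTo : ∀ n x → windows n x ≡ applyUpTo (λ i → sub x i n) (suc (length x) ∸ n)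
windows≡applyUpTo n x with length x <ᵇ n in eq
... | true rewrite m≤n⇒m∸n≡0 (<ᵇ⇒< (length x) n (subst T (sym eq) tt)) = refl
... | false = trans (map-upTo (λ i → sub x i n) (suc (length x ∸ n)))
                    (cong (applyUpTo (λ i → sub x i n)) (sym (+-∸-assoc 1 {length x} {n} (≮⇒≥ λ lt → subst T eq (<⇒<ᵇ lt)))))

InjectiveBelow : {A : Set} → ℕ → (ℕ → A) → Set
InjectiveBelow m f = ∀ {i j} → i < m → j < m → f i ≡ f j → i ≡ j

Unique-applyUpTo⇒injective : ∀ (f : ℕ → Bits) m → Unique (applyUpTo f m) → InjectiveBelow m f
Unique-applyUpTo⇒injective f (suc m) (f0∉ ∷ u) {zero}  {zero}  _       _       _ = refl
Unique-applyUpTo⇒injective f (suc m) (f0∉ ∷ u) {zero}  {suc j} _       (s≤s q) e = ⊥-elim (All.lookup f0∉ (∈-applyUpTo⁺ (f ∘ suc) q) e)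
Unique-applyUpTo⇒injective f (suc m) (f0∉ ∷ u) {suc i} {zero}  (s≤s p) _       e = ⊥-elim (All.lookup f0∉ (∈-applyUpTo⁺ (f ∘ suc) p) (sym e))
Unique-applyUpTo⇒injective f (suc m) (f0∉ ∷ u) {suc i} {suc j} (s≤s p) (s≤s q) e = cong suc (Unique-applyUpTo⇒injective (f ∘ suc) m u p q e)

injective⇒Unique-applyUpTo : ∀ (f : ℕ → Bits) m → InjectiveBelow m f → Unique (applyUpTo f m)
injective⇒Unique-applyUpTo f m inj = Unique.applyUpTo⁺₁ f m (λ i<j j<m e → <⇒≢ i<j (inj (<-trans i<j j<m) j<m e))

injective⇒surjective : ∀ {n} {f : Fin.Fin n → Fin.Fin n} → (∀ {i j} → f i ≡ f j → i ≡ j) → ∀ y → ∃ λ x → f x ≡ y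
injective⇒surjective {zero}  _   ()
injective⇒surjective {suc n} {f} inj y with Fin.any? (λ x → f x Fin.≟ y)
... | yes hit  = hit
... | no  miss = contradiction (Fin.injective⇒≤ {f = avoid} (λ e → inj (Fin.punchOut-injective {i = y} _ _ e))) 1+n≰n
  where
  avoid : Fin.Fin (suc n) → Fin.Fin n
  avoid x = Fin.punchOut {i = y} {j = f x} (miss ∘ (x ,_) ∘ sym)

module _ {m n} (f : ℕ → ℕ) (f< : ∀ {i} → i < m → f i < n) where

  private
    restrict : Fin.Fin m → Fin.Fin n
    restrict i = Fin.fromℕ< (f< (Fin.toℕ<n i))

    toℕ-restrict : ∀ i → Fin.toℕ (restrict i) ≡ f (Fin.toℕ i)
    toℕ-restrict i = Fin.toℕ-fromℕ< _

    restrict-injective : InjectiveBelow m f → ∀ {i j} → restrict i ≡ restrict j → i ≡ j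
    restrict-injective inj e = Fin.toℕ-injective (inj (Fin.toℕ<n _) (Fin.toℕ<n _)
      (trans (sym (toℕ-restrict _)) (trans (cong Fin.toℕ e) (toℕ-restrict _))))

  injectiveBelow⇒≤ : InjectiveBelow m f → m ≤ n
  injectiveBelow⇒≤ inj = Fin.injective⇒≤ (restrict-injective inj)

  injectiveBelow⇒surjective : m ≡ n → InjectiveBelow m f → ∀ {y} → y < n → ∃ λ i → i < m × f i ≡ y
  injectiveBelow⇒surjective refl inj y<n with injective⇒surjective (restrict-injective inj) (Fin.fromℕ< y<n)
  ... | i , e = Fin.toℕ i , Fin.toℕ<n i , trans (sym (toℕ-restrict i)) (trans (cong Fin.toℕ e) (Fin.toℕ-fromℕ< y<n))

value : Bits → ℕ
value []      = 0
value (b ∷ w) = (if b then 2 ^ length w else 0) + value w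

value<2^length : ∀ w → value w < 2 ^ length w
value<2^length []          = s≤s z≤n
value<2^length (false ∷ w) = ≤-trans (value<2^length w) (m≤m+n (2 ^ length w) _)
value<2^length (true ∷ w)  = +-monoʳ-< (2 ^ length w) (≤-trans (value<2^length w) (m≤m+n (2 ^ length w) 0))

bits : ℕ → ℕ → Bits
bits zero    j = []
bits (suc l) j with j <? 2 ^ l
... | yes _ = false ∷ bits l j
... | no  _ = true ∷ bits l (j ∸ 2 ^ l)

length-bits : ∀ l j → length (bits l j) ≡ l
length-bits zero    j = refl
length-bits (suc l) j with j <? 2 ^ l
... | yes _ = cong suc (length-bits l j)
... | no  _ = cong suc (length-bits l (j ∸ 2 ^ l))

value-bits : ∀ l j → j < 2 ^ l → value (bits l j) ≡ j
value-bits zero    zero    _         = refl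
value-bits zero    (suc j) (s≤s ())
value-bits (suc l) j       j<2^[1+l] with j <? 2 ^ l
... | yes j<2^l = value-bits l j j<2^l
... | no  j≮2^l rewrite length-bits l (j ∸ 2 ^ l) =
  trans (cong (2 ^ l +_) (value-bits l (j ∸ 2 ^ l) rest<)) (m+[n∸m]≡n (≮⇒≥ j≮2^l))
  where
  rest< : j ∸ 2 ^ l < 2 ^ l
  rest< = +-cancelˡ-< (2 ^ l) _ _ (subst₂ _<_ (sym (m+[n∸m]≡n (≮⇒≥ j≮2^l))) (cong (2 ^ l +_) (+-identityʳ (2 ^ l))) j<2^[1+l])

bits-value : ∀ w → bits (length w) (value w) ≡ w
bits-value []          = refl
bits-value (false ∷ w) with value w <? 2 ^ length w
... | yes _ = cong (false ∷_) (bits-value w)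
... | no  ≮ = contradiction (value<2^length w) ≮
bits-value (true ∷ w) with 2 ^ length w + value w <? 2 ^ length w
... | yes < = contradiction (m≤m+n (2 ^ length w) (value w)) (<⇒≱ <)
... | no  _ = cong (true ∷_) (trans (cong (bits (length w)) (m+n∸m≡n (2 ^ length w) (value w))) (bits-value w))

value-injective : ∀ u v → length u ≡ length v → value u ≡ value v → u ≡ v
value-injective u v |u|≡|v| e = trans (sym (bits-value u)) (trans (cong₂ bits |u|≡|v| e) (bits-value v))

take-++ˡ : ∀ n (u y : Bits) → n ≤ length u → take n (u ++ y) ≡ take n u
take-++ˡ zero    u       y _       = refl
take-++ˡ (suc n) (a ∷ u) y (s≤s p) = cong (a ∷_) (take-++ˡ n u y p)

drop-++ˡ : ∀ i (x y : Bits) → i ≤ length x → drop i (x ++ y) ≡ drop i x ++ y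
drop-++ˡ zero    x       y _       = refl
drop-++ˡ (suc i) (a ∷ x) y (s≤s p) = drop-++ˡ i x y p

bool-pigeonhole : ∀ (p q r : Bool) → p ≡ q ⊎ p ≡ r ⊎ q ≡ r
bool-pigeonhole false false _     = inj₁ refl
bool-pigeonhole true  true  _     = inj₁ refl
bool-pigeonhole false true  false = inj₂ (inj₁ refl)
bool-pigeonhole true  false true  = inj₂ (inj₁ refl)
bool-pigeonhole false true  true  = inj₂ (inj₂ refl)
bool-pigeonhole true  false false = inj₂ (inj₂ refl)

take-suc : ∀ j (z : Bits) → suc j ≤ length z → take (suc j) z ≡ take j z ++ [ at z j ]
take-suc zero    (a ∷ z) _       = refl
take-suc (suc j) (a ∷ z) (s≤s p) = cong (a ∷_) (take-suc j z p)

drop-at : ∀ i (y : Bits) → i < length y → drop i y ≡ at y i ∷ drop (suc i) y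
drop-at zero    (a ∷ y) _       = refl
drop-at (suc i) (a ∷ y) (s≤s p) = drop-at i y p

length-∷ʳ : ∀ (x : Bits) b → length (x ++ [ b ]) ≡ suc (length x)
length-∷ʳ x b = trans (length-++ x) (+-comm (length x) 1)

m<o∸n⇒m+1+n≤o : ∀ o n m → m < o ∸ n → m + suc n ≤ o
m<o∸n⇒m+1+n≤o o       zero    m p = subst (_≤ o) (+-comm 1 m) p
m<o∸n⇒m+1+n≤o (suc o) (suc n) m p = subst (_≤ suc o) (sym (+-suc m (suc n))) (s≤s (m<o∸n⇒m+1+n≤o o n m p))

-- Windows of length k + 1 are the edges of the de Bruijn graph on nodes of length k.
module Greedy (k : ℕ) where

  windowCount : Bits → ℕ
  windowCount x = length x ∸ k

  window : Bits → ℕ → Bits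
  window x i = sub x i (suc k)

  lastNode : Bits → Bits
  lastNode x = drop (windowCount x) x

  Occurs : Bits → Bits → Set
  Occurs x w = ∃ λ j → j < windowCount x × window x j ≡ w

  occurs? : ∀ x w → Dec (Occurs x w)
  occurs? x w = anyUpTo? (λ j → window x j ≟bits w) (windowCount x)

  window-fits : ∀ x {i} → i < windowCount x → i + suc k ≤ length x
  window-fits x {i} = m<o∸n⇒m+1+n≤o (length x) k i

  length-window : ∀ x {i} → i < windowCount x → length (window x i) ≡ suc k
  length-window x i< = length-sub x _ (suc k) (window-fits x i<)

  windows≡ : ∀ x → windows (suc k) x ≡ applyUpTo (window x) (windowCount x)
  windows≡ x = windows≡applyUpTo (suc k) x

  module _ (x : Bits) (b : Bool) (k≤ : k ≤ length x) where

    windowCount-∷ʳ : windowCount (x ++ [ b ]) ≡ suc (windowCount x)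
    windowCount-∷ʳ = trans (cong (_∸ k) (length-∷ʳ x b)) (+-∸-assoc 1 k≤)

    window-∷ʳ : ∀ {i} → i < windowCount x → window (x ++ [ b ]) i ≡ window x i
    window-∷ʳ {i} i< = trans (cong (take (suc k)) (drop-++ˡ i x [ b ] (m+n≤o⇒m≤o i fits)))
                             (take-++ˡ (suc k) (drop i x) [ b ] (subst (suc k ≤_) (sym (length-drop i x))
                               (m+n≤o⇒m≤o∸n (suc k) (subst (_≤ length x) (+-comm i (suc k)) fits))))
      where fits = window-fits x i<

    window-new : window (x ++ [ b ]) (windowCount x) ≡ lastNode x ++ [ b ]
    window-new = trans (cong (take (suc k)) (drop-++ˡ (windowCount x) x [ b ] (m∸n≤m (length x) k)))
                       (take-all (suc k) _ (≤-reflexive (trans (length-∷ʳ (lastNode x) b)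
                         (cong suc (trans (length-drop (windowCount x) x) (m∸[m∸n]≡n k≤))))))

    old-or-new : ∀ {i} → i < windowCount (x ++ [ b ]) → i < windowCount x ⊎ i ≡ windowCount x
    old-or-new {i} i< = m<1+n⇒m<n∨m≡n (subst (i <_) windowCount-∷ʳ i<)

    occurs-∷ʳ : ∀ {w} → Occurs x w → Occurs (x ++ [ b ]) w
    occurs-∷ʳ (j , j< , e) = j , subst (j <_) (sym windowCount-∷ʳ) (m<n⇒m<1+n j<) , trans (window-∷ʳ j<) e

  record Invariant (x : Bits) : Set where
    field
      prefix-length    : k ≤ length x
      prefix-ones      : ∀ i → i < k → at x i ≡ true
      window-injective : InjectiveBelow (windowCount x) (window x)
      -- 1 is appended only after appending 0 failed
      one⇒zero         : ∀ v → Occurs x (v ++ [ true ]) → Occurs x (v ++ [ false ])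

  module _ {x : Bits} (I : Invariant x) (b : Bool) where
    open Invariant I

    repeated⇒occurs : ¬ Unique (windows (suc k) (x ++ [ b ])) → Occurs x (lastNode x ++ [ b ])
    repeated⇒occurs repeated with occurs? x (lastNode x ++ [ b ])
    ... | yes occ = occ
    ... | no ¬occ = contradiction (subst Unique (sym (windows≡ (x ++ [ b ])))
                                     (injective⇒Unique-applyUpTo _ _ injective)) repeated
      where
      old = window-∷ʳ x b prefix-length
      new = window-new x b prefix-length
      injective : InjectiveBelow (windowCount (x ++ [ b ])) (window (x ++ [ b ]))
      injective i< j< e with old-or-new x b prefix-length i< | old-or-new x b prefix-length j<
      ... | inj₁ i<′ | inj₁ j<′ = window-injective i<′ j<′ (trans (sym (old i<′)) (trans e (old j<′)))
      ... | inj₂ refl | inj₂ refl = refl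
      ... | inj₂ refl | inj₁ j<′ = contradiction (_ , j<′ , trans (sym (old j<′)) (trans (sym e) new)) ¬occ
      ... | inj₁ i<′ | inj₂ refl = contradiction (_ , i<′ , trans (sym (old i<′)) (trans e new)) ¬occ

    invariant-∷ʳ : Unique (windows (suc k) (x ++ [ b ])) →
                   (b ≡ true → Occurs x (lastNode x ++ [ false ])) → Invariant (x ++ [ b ])
    invariant-∷ʳ unique zero-tried = record
      { prefix-length    = ≤-trans prefix-length (≤-trans (n≤1+n (length x)) (≤-reflexive (sym (length-∷ʳ x b))))
      ; prefix-ones      = λ i i<k → trans (at-++ˡ x [ b ] i (≤-trans i<k prefix-length)) (prefix-ones i i<k)
      ; window-injective = Unique-applyUpTo⇒injective _ _ (subst Unique (windows≡ (x ++ [ b ])) unique)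
      ; one⇒zero         = one⇒zero′
      }
      where
      one⇒zero′ : ∀ v → Occurs (x ++ [ b ]) (v ++ [ true ]) → Occurs (x ++ [ b ]) (v ++ [ false ])
      one⇒zero′ v (i , i< , e) with old-or-new x b prefix-length i<
      ... | inj₁ i<′ = occurs-∷ʳ x b prefix-length (one⇒zero v (i , i<′ , trans (sym (window-∷ʳ x b prefix-length i<′)) e))
      ... | inj₂ refl with ∷ʳ-injective (lastNode x) v (trans (sym (window-new x b prefix-length)) e)
      ...   | refl , refl = occurs-∷ʳ x b prefix-length (zero-tried refl)

  Stuck : Bits → Set
  Stuck y = ∀ b → Occurs y (lastNode y ++ [ b ])

  Outcome : ℕ → Bits → Bits → Set
  Outcome f x y = Invariant y × (Stuck y ⊎ length x + f ≤ length y)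

  outcome-∷ʳ : ∀ x f {y} b → Outcome f (x ++ [ b ]) y → Outcome (suc f) x y
  outcome-∷ʳ x f b (I , inj₁ stuck) = I , inj₁ stuck
  outcome-∷ʳ x f {y} b (I , inj₂ long) =
    I , inj₂ (subst (_≤ length y) (trans (cong (_+ f) (length-∷ʳ x b)) (sym (+-suc (length x) f))) long)

  greedy-invariant : ∀ f x → Invariant x → Outcome f x (greedy (suc k) f x)
  greedy-invariant zero    x I = I , inj₂ (≤-reflexive (+-identityʳ (length x)))
  greedy-invariant (suc f) x I with unique? (windows (suc k) (x ++ [ false ]))
  ... | yes u = outcome-∷ʳ x f false (greedy-invariant f (x ++ [ false ]) (invariant-∷ʳ I false u λ ()))
  ... | no ¬u with unique? (windows (suc k) (x ++ [ true ]))
  ...   | yes u = outcome-∷ʳ x f true (greedy-invariant f (x ++ [ true ]) (invariant-∷ʳ I true u λ _ → repeated⇒occurs I false ¬u))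
  ...   | no ¬u′ = I , inj₁ λ { false → repeated⇒occurs I false ¬u ; true → repeated⇒occurs I true ¬u′ }

  windowCount≤2^ : ∀ {y} → Invariant y → windowCount y ≤ 2 ^ suc k
  windowCount≤2^ {y} I = injectiveBelow⇒≤ (value ∘ window y)
    (λ {i} i< → subst (λ l → value (window y i) < 2 ^ l) (length-window y i<) (value<2^length (window y i)))
    (λ i< j< e → Invariant.window-injective I i< j< (value-injective _ _ (trans (length-window y i<) (sym (length-window y j<))) e))

  initial : Bits
  initial = replicate k true

  initial-invariant : Invariant initial
  initial-invariant = record
    { prefix-length    = ≤-reflexive (sym (length-replicate k))
    ; prefix-ones      = λ i i<k → at-replicate k true i i<k
    ; window-injective = λ {i} i< _ _ → contradiction (subst (i <_) no-windows i<) n≮0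
    ; one⇒zero         = λ { v (i , i< , _) → contradiction (subst (i <_) no-windows i<) n≮0 }
    }
    where
    no-windows : windowCount initial ≡ 0
    no-windows = trans (cong (_∸ k) (length-replicate k)) (n∸n≡0 k)

  y : Bits
  y = greedy (suc k) (2 ^ suc k + 1) initial

  y-invariant : Invariant y
  y-invariant = proj₁ (greedy-invariant (2 ^ suc k + 1) initial initial-invariant)

  -- The fuel 2^(k+1) + 1 exceeds the number of distinct windows, so it never runs out.
  y-stuck : Stuck y
  y-stuck with proj₂ (greedy-invariant (2 ^ suc k + 1) initial initial-invariant)
  ... | inj₁ stuck = stuck
  ... | inj₂ long  = contradiction (≤-trans too-many (windowCount≤2^ y-invariant)) (subst (_≰ 2 ^ suc k) (+-comm 1 _) 1+n≰n)
    where
    too-many : 2 ^ suc k + 1 ≤ windowCount y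
    too-many = m+n≤o⇒m≤o∸n (2 ^ suc k + 1)
                 (subst (_≤ length y) (trans (cong (_+ (2 ^ suc k + 1)) (length-replicate k)) (+-comm k _)) long)

  open Invariant y-invariant

  m : ℕ
  m = windowCount y

  node : ℕ → Bits
  node i = sub y i k

  window≡node∷ʳ : ∀ {i} → i < m → window y i ≡ node i ++ [ at y (i + k) ]
  window≡node∷ʳ {i} i< = trans (take-suc k (drop i y) (subst (suc k ≤_) (sym (length-drop i y))
                                  (m+n≤o⇒m≤o∸n (suc k) (subst (_≤ length y) (+-comm i (suc k)) (window-fits y i<)))))
                               (cong (λ z → node i ++ [ z ]) (at-drop y i k))

  window≡∷node : ∀ {i} → i < m → window y i ≡ at y i ∷ node (suc i)
  window≡∷node {i} i< = cong (take (suc k)) (drop-at i y (≤-trans (s≤s (m≤m+n i k))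
                          (subst (_≤ length y) (+-suc i k) (window-fits y i<))))

  window≡⇒node≡ : ∀ {j u b} → j < m → window y j ≡ u ++ [ b ] → node j ≡ u
  window≡⇒node≡ {j} j< e = ∷ʳ-injectiveˡ (node j) _ (trans (sym (window≡node∷ʳ j<)) e)

  node-first : node 0 ≡ replicate k true
  node-first = at-ext (take k y) (replicate k true) (trans |take| (sym (length-replicate k)))
    λ i i< → let i<k = subst (i <_) |take| i< in
             trans (at-take y k i i<k) (trans (prefix-ones i i<k) (sym (at-replicate k true i i<k)))
    where
    |take| : length (take k y) ≡ k
    |take| = trans (length-take k y) (m≤n⇒m⊓n≡m prefix-length)

  node-last : node m ≡ lastNode y
  node-last = take-all k (lastNode y) (≤-reflexive (trans (length-drop m y) (m∸[m∸n]≡n prefix-length)))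

  same-bit⇒same-position : ∀ {i j u} → i < m → j < m → window y i ≡ at y i ∷ u → window y j ≡ at y j ∷ u →
                           at y i ≡ at y j → i ≡ j
  same-bit⇒same-position {u = u} i< j< eᵢ eⱼ bit = window-injective i< j< (trans eᵢ (trans (cong (_∷ u) bit) (sym eⱼ)))

  instance
    m-nonZero : NonZero m
    m-nonZero = >-nonZero (≤-trans (s≤s z≤n) (proj₁ (proj₂ (y-stuck false))))

  last : ℕ
  last = pred m

  suc-last : suc last ≡ m
  suc-last = suc-pred m

  last<m : last < m
  last<m = subst (last <_) suc-last ≤-refl

  suc<m⇒<last : ∀ {a} → suc a < m → a < last
  suc<m⇒<last {a} a< = ≤-pred (subst (suc (suc a) ≤_) (sym suc-last) a<)

  window-last : window y last ≡ at y last ∷ lastNode y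
  window-last = trans (window≡∷node last<m) (cong (at y last ∷_) (trans (cong node suc-last) node-last))

  window-before : ∀ {a u b} → suc a < m → window y (suc a) ≡ u ++ [ b ] → window y a ≡ at y a ∷ u
  window-before {a} a< e = trans (window≡∷node (<-trans (n<1+n a) a<)) (cong (at y a ∷_) (window≡⇒node≡ a< e))

  ¬three-entering : ∀ {u i j l} → i < m → j < m → l < m → i ≢ j → i ≢ l → j ≢ l →
                    window y i ≡ at y i ∷ u → window y j ≡ at y j ∷ u → window y l ≡ at y l ∷ u → ⊥
  ¬three-entering i< j< l< i≢j i≢l j≢l eᵢ eⱼ eₗ with bool-pigeonhole (at y _) (at y _) (at y _)
  ... | inj₁ same        = i≢j (same-bit⇒same-position i< j< eᵢ eⱼ same)
  ... | inj₂ (inj₁ same) = i≢l (same-bit⇒same-position i< l< eᵢ eₗ same)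
  ... | inj₂ (inj₂ same) = j≢l (same-bit⇒same-position j< l< eⱼ eₗ same)

  -- Both windows leaving the last node exist; if neither were at position 0, the
  -- last node would be entered at three distinct positions.
  lastNode-ones : lastNode y ≡ replicate k true
  lastNode-ones with y-stuck false | y-stuck true
  ... | zero , 0< , e | _ = trans (sym (window≡⇒node≡ 0< e)) node-first
  ... | suc a , _ , _ | zero , 0< , e = trans (sym (window≡⇒node≡ 0< e)) node-first
  ... | suc a , a< , e₀ | suc c , c< , e₁ =
    ⊥-elim (¬three-entering (<-trans (n<1+n a) a<) (<-trans (n<1+n c) c<) last<m a≢c
                            (<⇒≢ (suc<m⇒<last a<)) (<⇒≢ (suc<m⇒<last c<))
                            (window-before a< e₀) (window-before c< e₁) window-last)
    where
    a≢c : a ≢ c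
    a≢c refl = contradiction (∷ʳ-injectiveʳ _ _ (trans (sym e₀) e₁)) λ ()

  previous : ℕ → ℕ
  previous zero    = last
  previous (suc a) = a

  previous<m : ∀ {j} → j < m → previous j < m
  previous<m {zero}  _  = last<m
  previous<m {suc a} a< = <-trans (n<1+n a) a<

  previous-injective : InjectiveBelow m previous
  previous-injective {zero}  {zero}  _  _  _ = refl
  previous-injective {suc a} {suc c} _  _  e = cong suc e
  previous-injective {zero}  {suc c} _  c< e = contradiction (sym e) (<⇒≢ (suc<m⇒<last c<))
  previous-injective {suc a} {zero}  a< _  e = contradiction e (<⇒≢ (suc<m⇒<last a<))

  -- Cyclically, position 0 is entered from the last window, since node 0 = lastNode y.
  window-previous : ∀ {j u} → j < m → node j ≡ u → window y (previous j) ≡ at y (previous j) ∷ u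
  window-previous {zero}  _  e = trans window-last (cong (at y last ∷_) (trans lastNode-ones (trans (sym node-first) e)))
  window-previous {suc a} a< e = trans (window≡∷node (<-trans (n<1+n a) a<)) (cong (at y a ∷_) e)

  -- The windows preceding the two leaving u enter u at distinct positions, hence with distinct first bits.
  both-entering : ∀ u → Occurs y (u ++ [ false ]) → Occurs y (u ++ [ true ]) → ∀ b → Occurs y (b ∷ u)
  both-entering u (j₀ , j₀< , e₀) (j₁ , j₁< , e₁) b with b ≟𝔹 at y (previous j₀)
  ... | yes refl = previous j₀ , previous<m j₀< , window-previous j₀< (window≡⇒node≡ j₀< e₀)
  ... | no  b≢   = previous j₁ , previous<m j₁< , trans (window-previous j₁< (window≡⇒node≡ j₁< e₁)) (cong (_∷ u) (sym b≡))
    where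
    distinct : at y (previous j₀) ≢ at y (previous j₁)
    distinct same = contradiction (∷ʳ-injectiveʳ u u (trans (sym e₀) (trans (cong (window y) j₀≡j₁) e₁))) λ ()
      where
      j₀≡j₁ = previous-injective j₀< j₁< (same-bit⇒same-position (previous<m j₀<) (previous<m j₁<)
                (window-previous j₀< (window≡⇒node≡ j₀< e₀)) (window-previous j₁< (window≡⇒node≡ j₁< e₁)) same)
    b≡ : b ≡ at y (previous j₁)
    b≡ = trans (¬-not b≢) (sym (¬-not (distinct ∘ sym)))

  padded : Bits → Bits
  padded a = a ++ replicate (k ∸ length a) true

  ∷-padded : ∀ c a → suc (length a) ≤ k → c ∷ padded a ≡ padded (c ∷ a) ++ [ true ]
  ∷-padded c a a< = cong (c ∷_) (begin
    a ++ replicate (k ∸ length a) true           ≡⟨ cong (λ r → a ++ replicate r true) (+-∸-assoc 1 a<) ⟩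
    a ++ replicate (suc r) true                  ≡⟨ cong (a ++_) (replicate-∷ʳ r) ⟩
    a ++ (replicate r true ++ [ true ])          ≡⟨ sym (++-assoc a (replicate r true) [ true ]) ⟩
    (a ++ replicate r true) ++ [ true ]          ∎)
    where
    open ≡-Reasoning
    r = k ∸ suc (length a)
    replicate-∷ʳ : ∀ r → replicate (suc r) true ≡ replicate r true ++ [ true ]
    replicate-∷ʳ zero    = refl
    replicate-∷ʳ (suc r) = cong (true ∷_) (replicate-∷ʳ r)

  occurs-padded : ∀ a → length a ≤ k → ∀ b → Occurs y (padded a ++ [ b ])
  occurs-padded []      _  b = subst (λ u → Occurs y (u ++ [ b ])) lastNode-ones (y-stuck b)
  occurs-padded (c ∷ a) a< b = last-bit b
    where
    occ₁ : Occurs y (padded (c ∷ a) ++ [ true ])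
    occ₁ = subst (Occurs y) (∷-padded c a a<)
             (both-entering (padded a) (occurs-padded a (<⇒≤ a<) false) (occurs-padded a (<⇒≤ a<) true) c)
    last-bit : ∀ b → Occurs y (padded (c ∷ a) ++ [ b ])
    last-bit true  = occ₁
    last-bit false = one⇒zero (padded (c ∷ a)) occ₁

  occurs-all : ∀ w → length w ≡ suc k → Occurs y w
  occurs-all w |w| with initLast w
  ... | []      = contradiction |w| λ ()
  ... | a ∷ʳ′ b = subst (λ u → Occurs y (u ++ [ b ])) padded-a (occurs-padded a (≤-reflexive |a|) b)
    where
    |a| : length a ≡ k
    |a| = suc-injective (trans (sym (length-∷ʳ a b)) |w|)
    padded-a : padded a ≡ a
    padded-a = trans (cong (λ r → a ++ replicate r true) (trans (cong (k ∸_) |a|) (n∸n≡0 k))) (++-identityʳ a)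

  windowCount≡2^ : m ≡ 2 ^ suc k
  windowCount≡2^ = ≤-antisym (windowCount≤2^ y-invariant)
                             (injectiveBelow⇒≤ positionOf (λ {j} _ → proj₁ (proj₂ (find j))) injective)
    where
    find : ∀ j → Occurs y (bits (suc k) j)
    find j = occurs-all (bits (suc k) j) (length-bits (suc k) j)
    positionOf : ℕ → ℕ
    positionOf = proj₁ ∘ find
    injective : InjectiveBelow (2 ^ suc k) positionOf
    injective {i} {j} i< j< e = begin
      i                                  ≡⟨ sym (value-bits (suc k) i i<) ⟩
      value (bits (suc k) i)             ≡⟨ cong value (trans (sym (proj₂ (proj₂ (find i))))
                                                        (trans (cong (window y) e) (proj₂ (proj₂ (find j))))) ⟩
      value (bits (suc k) j)             ≡⟨ value-bits (suc k) j j< ⟩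
      j ∎
      where open ≡-Reasoning

length-concat-uniform : ∀ c (f : ℕ → Bits) T → (∀ i → length (f i) ≡ T) → length (concat (applyUpTo f c)) ≡ c * T
length-concat-uniform zero    f T |f| = refl
length-concat-uniform (suc c) f T |f| = trans (length-++ (f 0)) (cong₂ _+_ (|f| 0) (length-concat-uniform c (f ∘ suc) T (|f| ∘ suc)))

at-concat-uniform : ∀ c (f : ℕ → Bits) T .{{_ : NonZero T}} → (∀ i → length (f i) ≡ T) →
                    ∀ p → p < c * T → at (concat (applyUpTo f c)) p ≡ at (f (p / T)) (p % T)
at-concat-uniform (suc c) f T |f| p p< with at-++-split (f 0) (concat (applyUpTo (f ∘ suc) c)) p
  (subst (p <_) (sym (cong₂ _+_ (|f| 0) (length-concat-uniform c (f ∘ suc) T (|f| ∘ suc)))) p<)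
... | inj₁ (p<f₀ , e) = trans e (cong₂ (λ a b → at (f a) b) (sym (m<n⇒m/n≡0 p<T)) (sym (m<n⇒m%n≡m p<T)))
  where p<T = subst (p <_) (|f| 0) p<f₀
... | inj₂ (j , j< , refl , e) rewrite |f| 0 = begin
  at (concat (applyUpTo f (suc c))) (T + j)        ≡⟨ e ⟩
  at (concat (applyUpTo (f ∘ suc) c)) j            ≡⟨ at-concat-uniform c (f ∘ suc) T (|f| ∘ suc) j j<cT ⟩
  at (f (suc (j / T))) (j % T)                     ≡⟨ cong₂ (λ a b → at (f a) b) (sym quotient) (sym remainder) ⟩
  at (f ((T + j) / T)) ((T + j) % T)               ∎
  where
  open ≡-Reasoning
  j<cT : j < c * T
  j<cT = subst (j <_) (length-concat-uniform c (f ∘ suc) T (|f| ∘ suc)) j<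
  quotient : (T + j) / T ≡ suc (j / T)
  quotient = trans (m/n≡1+[m∸n]/n (m≤m+n T j)) (cong (λ z → suc (z / T)) (m+n∸m≡n T j))
  remainder : (T + j) % T ≡ j % T
  remainder = trans (cong (_% T) (+-comm T j)) ([m+n]%n≡m%n j T)

pow≡concat : ∀ (x : Bits) t → pow x t ≡ concat (applyUpTo (λ _ → x) t)
pow≡concat x zero    = refl
pow≡concat x (suc t) = cong (x ++_) (pow≡concat x t)

length-pow : ∀ (x : Bits) t → length (pow x t) ≡ t * length x
length-pow x t = trans (cong length (pow≡concat x t)) (length-concat-uniform t (λ _ → x) (length x) (λ _ → refl))

at-pow : ∀ (x : Bits) t {L} .{{_ : NonZero L}} → length x ≡ L → ∀ p → p < t * L → at (pow x t) p ≡ at x (p % L)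
at-pow x t refl p p< = trans (cong (λ z → at z p) (pow≡concat x t)) (at-concat-uniform t (λ _ → x) (length x) (λ _ → refl) p p<)

length-rotate : ∀ i (x : Bits) → length (drop i x ++ take i x) ≡ length x
length-rotate zero    x       = trans (length-++ x) (+-identityʳ (length x))
length-rotate (suc i) []      = refl
length-rotate (suc i) (a ∷ x) = trans (length-++ (drop i x))
  (trans (+-suc (length (drop i x)) (length (take i x))) (cong suc (trans (sym (length-++ (drop i x))) (length-rotate i x))))

at-rotate : ∀ (x : Bits) {L} .{{_ : NonZero L}} → length x ≡ L → ∀ i r → i ≤ L → r < L →
            at (drop i x ++ take i x) r ≡ at x ((i + r) % L)
at-rotate x refl i r i≤ r< with at-++-split (drop i x) (take i x) r
  (subst (r <_) (sym (trans (sym (length-++ (drop i x))) (length-rotate i x))) r<)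
... | inj₁ (r<drop , e) = trans e (trans (at-drop x i r) (cong (at x) (sym (m<n⇒m%n≡m i+r<))))
  where
  i+r< : i + r < length x
  i+r< = subst (i + r <_) (m+[n∸m]≡n i≤) (+-monoʳ-< i (subst (r <_) (length-drop i x) r<drop))
... | inj₂ (j , j< , refl , e) = begin
  at (drop i x ++ take i x) (length (drop i x) + j) ≡⟨ e ⟩
  at (take i x) j                                   ≡⟨ at-take x i j j<i ⟩
  at x j                                            ≡⟨ cong (at x) (sym (m<n⇒m%n≡m (<-≤-trans j<i i≤))) ⟩
  at x (j % length x)                               ≡⟨ cong (at x) (sym ([m+n]%n≡m%n j (length x))) ⟩
  at x ((j + length x) % length x)                  ≡⟨ cong (λ z → at x (z % length x)) wrap ⟩
  at x ((i + (length (drop i x) + j)) % length x)   ∎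
  where
  open ≡-Reasoning
  j<i : j < i
  j<i = subst (j <_) (trans (length-take i x) (m≤n⇒m⊓n≡m i≤)) j<
  wrap : j + length x ≡ i + (length (drop i x) + j)
  wrap = begin
    j + length x                     ≡⟨ +-comm j (length x) ⟩
    length x + j                     ≡⟨ cong (_+ j) (sym (m+[n∸m]≡n i≤)) ⟩
    i + (length x ∸ i) + j           ≡⟨ +-assoc i _ j ⟩
    i + (length x ∸ i + j)           ≡⟨ cong (λ z → i + (z + j)) (sym (length-drop i x)) ⟩
    i + (length (drop i x) + j)      ∎

m%2≢0⇒m%2≡1 : ∀ m → m % 2 ≢ 0 → m % 2 ≡ 1
m%2≢0⇒m%2≡1 m m%2≢0 with m % 2 | m%n<n m 2
... | zero        | _                 = contradiction refl m%2≢0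
... | suc zero    | _                 = refl
... | suc (suc _) | s≤s (s≤s ())

m%2≡0⇒m≡2*[m/2] : ∀ m → m % 2 ≡ 0 → m ≡ 2 * (m / 2)
m%2≡0⇒m≡2*[m/2] m even = trans (m≡m%n+[m/n]*n m 2) (trans (cong (_+ m / 2 * 2) even) (*-comm (m / 2) 2))

split2-correct : ∀ f m → 1 ≤ m → m ≤ f →
                 2 ^ proj₁ (split2 f m) * proj₂ (split2 f m) ≡ m × proj₂ (split2 f m) % 2 ≡ 1
split2-correct zero    m 1≤m m≤0 = contradiction (≤-trans 1≤m m≤0) λ ()
split2-correct (suc f) m 1≤m m≤ with m ≡ᵇ 0 in m≡ᵇ0 | m % 2 ≡ᵇ 0 in m%2≡ᵇ0
... | true  | _     = contradiction (≡ᵇ⇒≡ m 0 (subst T (sym m≡ᵇ0) tt)) (<⇒≢ 1≤m ∘ sym)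
... | false | false = *-identityˡ m , m%2≢0⇒m%2≡1 m (λ m%2≡0 → subst T m%2≡ᵇ0 (≡⇒≡ᵇ (m % 2) 0 m%2≡0))
... | false | true  = doubled , proj₂ ih
  where
  m≡2h : m ≡ 2 * (m / 2)
  m≡2h = m%2≡0⇒m≡2*[m/2] m (≡ᵇ⇒≡ (m % 2) 0 (subst T (sym m%2≡ᵇ0) tt))
  1≤h : 1 ≤ m / 2
  1≤h = n≢0⇒n>0 (λ h≡0 → <⇒≢ 1≤m (sym (trans m≡2h (cong (2 *_) h≡0))))
  ih = split2-correct f (m / 2) 1≤h (≤-pred (≤-trans (m/n<m m 2 {{>-nonZero 1≤m}} (s≤s (s≤s z≤n))) m≤))
  s′ = proj₁ (split2 f (m / 2))
  t′ = proj₂ (split2 f (m / 2))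
  doubled : 2 * 2 ^ s′ * t′ ≡ m
  doubled = trans (*-assoc 2 (2 ^ s′) t′) (trans (cong (2 *_) (proj₁ ih)) (sym m≡2h))

%-≡-+⇒∣ : ∀ B .{{_ : NonZero B}} x y → x % B ≡ (x + y) % B → B ∣ y
%-≡-+⇒∣ B x y e = ∣m+n∣m⇒∣n (divides ((x + y) / B) (+-cancelˡ-≡ (x % B) _ _ (begin
  x % B + (x / B * B + y)         ≡⟨ sym (+-assoc (x % B) _ y) ⟩
  x % B + x / B * B + y           ≡⟨ cong (_+ y) (sym (m≡m%n+[m/n]*n x B)) ⟩
  x + y                           ≡⟨ m≡m%n+[m/n]*n (x + y) B ⟩
  (x + y) % B + (x + y) / B * B   ≡⟨ cong (_+ (x + y) / B * B) (sym e) ⟩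
  x % B + (x + y) / B * B         ∎))) (n∣m*n (x / B))
  where open ≡-Reasoning

2^e∣odd*c⇒2^e∣c : ∀ e t c → t % 2 ≡ 1 → 2 ^ e ∣ t * c → 2 ^ e ∣ c
2^e∣odd*c⇒2^e∣c zero    t c _   _     = 1∣ c
2^e∣odd*c⇒2^e∣c (suc e) t c odd 2^e∣tc =
  subst (2 ^ suc e ∣_) (sym c≡2h) (*-monoʳ-∣ 2 (2^e∣odd*c⇒2^e∣c e t (c / 2) odd (*-cancelˡ-∣ 2 (subst (2 ^ suc e ∣_) tc≡ 2^e∣tc))))
  where
  c-even : c % 2 ≡ 0
  c-even with c % 2 ≟ 0
  ... | yes even = even
  ... | no  c-odd = contradiction (begin
    0                         ≡⟨ sym (n∣m⇒m%n≡0 (t * c) 2 (∣-trans (m∣m*n (2 ^ e)) 2^e∣tc)) ⟩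
    (t * c) % 2               ≡⟨ %-distribˡ-* t c 2 ⟩
    ((t % 2) * (c % 2)) % 2   ≡⟨ cong₂ (λ a b → (a * b) % 2) odd (m%2≢0⇒m%2≡1 c c-odd) ⟩
    1                         ∎) λ ()
    where open ≡-Reasoning
  c≡2h : c ≡ 2 * (c / 2)
  c≡2h = m%2≡0⇒m≡2*[m/2] c c-even
  tc≡ : t * c ≡ 2 * (t * (c / 2))
  tc≡ = trans (cong (t *_) c≡2h) (trans (sym (*-assoc t 2 (c / 2))) (trans (cong (_* (c / 2)) (*-comm t 2)) (*-assoc 2 t (c / 2))))

*-odd-%-injective-≤ : ∀ e t .{{_ : NonZero (2 ^ e)}} → t % 2 ≡ 1 →
                      ∀ {b b′} → b ≤ b′ → b′ < 2 ^ e → (b * t) % 2 ^ e ≡ (b′ * t) % 2 ^ e → b ≡ b′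
*-odd-%-injective-≤ e t odd {b} {b′} b≤b′ b′< eq = trans (sym (+-identityʳ b)) (trans (cong (b +_) (sym d≡0)) b+d≡b′)
  where
  d = b′ ∸ b
  b+d≡b′ : b + d ≡ b′
  b+d≡b′ = m+[n∸m]≡n b≤b′
  2^e∣d : 2 ^ e ∣ d
  2^e∣d = 2^e∣odd*c⇒2^e∣c e t d odd (subst (2 ^ e ∣_) (*-comm d t) (%-≡-+⇒∣ (2 ^ e) (b * t) (d * t)
            (trans eq (cong (_% 2 ^ e) (trans (cong (_* t) (sym b+d≡b′)) (*-distribʳ-+ t b d))))))
  d≡0 : d ≡ 0
  d≡0 = trans (sym (m<n⇒m%n≡m (≤-<-trans (m∸n≤m b′ b) b′<))) (n∣m⇒m%n≡0 d (2 ^ e) 2^e∣d)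

*-odd-%-injective : ∀ e t .{{_ : NonZero (2 ^ e)}} → t % 2 ≡ 1 → InjectiveBelow (2 ^ e) (λ b → (b * t) % 2 ^ e)
*-odd-%-injective e t odd {b} {b′} b< b′< eq with ≤-total b b′
... | inj₁ b≤b′ = *-odd-%-injective-≤ e t odd b≤b′ b′< eq
... | inj₂ b′≤b = sym (*-odd-%-injective-≤ e t odd b′≤b b< (sym eq))

+-*-injective : ∀ A .{{_ : NonZero A}} {a a′ u u′} → a < A → a′ < A → a + A * u ≡ a′ + A * u′ → a ≡ a′ × u ≡ u′
+-*-injective A {a} {a′} {u} {u′} a< a′< e = a≡a′ , *-cancelˡ-≡ u u′ A (+-cancelˡ-≡ a _ _ (trans e (cong (_+ A * u′) (sym a≡a′))))
  where
  low : ∀ {a u} → a < A → (a + A * u) % A ≡ a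
  low {a} {u} a< = trans (cong (λ z → (a + z) % A) (*-comm A u)) (trans ([m+kn]%n≡m%n a u A) (m<n⇒m%n≡m a<))
  a≡a′ : a ≡ a′
  a≡a′ = trans (sym (low a<)) (trans (cong (_% A) e) (low a′<))

+-*-% : ∀ A M .{{_ : NonZero A}} .{{_ : NonZero M}} .{{_ : NonZero (A * M)}} a u → a < A → (a + A * u) % (A * M) ≡ a + A * (u % M)
+-*-% A M a u a< = begin
  (a + A * u) % (A * M)                       ≡⟨ cong (λ z → (a + A * z) % (A * M)) (m≡m%n+[m/n]*n u M) ⟩
  (a + A * (u % M + u / M * M)) % (A * M)     ≡⟨ cong (_% (A * M)) (solve 5 (λ a A r q M → a :+ A :* (r :+ q :* M) := (a :+ A :* r) :+ q :* (A :* M))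
                                                                        refl a A (u % M) (u / M) M) ⟩
  (a + A * (u % M) + u / M * (A * M)) % (A * M) ≡⟨ [m+kn]%n≡m%n (a + A * (u % M)) (u / M) (A * M) ⟩
  (a + A * (u % M)) % (A * M)                 ≡⟨ m<n⇒m%n≡m (<-≤-trans (+-monoˡ-< (A * (u % M)) a<)
                                                   (subst (_≤ A * M) (*-suc A (u % M)) (*-monoʳ-≤ A (m%n<n u M)))) ⟩
  a + A * (u % M)                             ∎
  where open ≡-Reasoning

offset-% : ∀ A M t .{{_ : NonZero A}} .{{_ : NonZero M}} .{{_ : NonZero (A * M)}} κ → κ < A * M →
           (κ / M + κ * (A * t)) % (A * M) ≡ κ / M + A * ((κ % M * t) % M)
offset-% A M t κ κ< = begin
  (q + κ * (A * t)) % (A * M)                 ≡⟨ cong (λ z → (q + z * (A * t)) % (A * M)) (m≡m%n+[m/n]*n κ M) ⟩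
  (q + (r + q * M) * (A * t)) % (A * M)       ≡⟨ cong (_% (A * M)) (solve 5 (λ q r M A t → q :+ (r :+ q :* M) :* (A :* t) := (q :+ A :* (r :* t)) :+ (q :* t) :* (A :* M))
                                                                        refl q r M A t) ⟩
  (q + A * (r * t) + q * t * (A * M)) % (A * M) ≡⟨ [m+kn]%n≡m%n (q + A * (r * t)) (q * t) (A * M) ⟩
  (q + A * (r * t)) % (A * M)                 ≡⟨ +-*-% A M q (r * t) (m<n*o⇒m/o<n κ<) ⟩
  q + A * ((r * t) % M)                       ∎
  where
  open ≡-Reasoning
  q = κ / M
  r = κ % M

-- The residue has radix-A digits κ / 2^e and (κ % 2^e) t mod 2^e, and the odd t permutes residues mod 2^e.
offset-injective : ∀ A e t .{{_ : NonZero A}} .{{_ : NonZero (2 ^ e)}} .{{_ : NonZero (A * 2 ^ e)}} → t % 2 ≡ 1 →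
                   InjectiveBelow (A * 2 ^ e) (λ κ → (κ / 2 ^ e + κ * (A * t)) % (A * 2 ^ e))
offset-injective A e t odd {κ} {κ′} κ< κ′< eq = begin
  κ                              ≡⟨ m≡m%n+[m/n]*n κ M ⟩
  κ % M + κ / M * M              ≡⟨ cong₂ (λ r q → r + q * M) rem≡ (proj₁ digits≡) ⟩
  κ′ % M + κ′ / M * M            ≡⟨ sym (m≡m%n+[m/n]*n κ′ M) ⟩
  κ′                             ∎
  where
  open ≡-Reasoning
  M = 2 ^ e
  digits≡ = +-*-injective A (m<n*o⇒m/o<n κ<) (m<n*o⇒m/o<n κ′<)
              (trans (sym (offset-% A M t κ κ<)) (trans eq (offset-% A M t κ′ κ′<)))
  rem≡ : κ % M ≡ κ′ % M
  rem≡ = *-odd-%-injective e t odd (m%n<n κ M) (m%n<n κ′ M) (proj₂ digits≡)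

n<2^n : ∀ n → n < 2 ^ n
n<2^n zero    = s≤s z≤n
n<2^n (suc n) = subst (_≤ 2 ^ suc n) (+-comm (suc n) 1) (+-mono-≤ (n<2^n n) (subst (1 ≤_) (sym (+-identityʳ (2 ^ n))) (m^n>0 2 n)))

[m%o+n]%o≡[m+n]%o : ∀ m n o .{{_ : NonZero o}} → (m % o + n) % o ≡ (m + n) % o
[m%o+n]%o≡[m+n]%o m n o = begin
  (m % o + n) % o             ≡⟨ %-distribˡ-+ (m % o) n o ⟩
  (m % o % o + n % o) % o     ≡⟨ cong (λ z → (z + n % o) % o) (m%n%n≡m%n m o) ⟩
  (m % o + n % o) % o         ≡⟨ sym (%-distribˡ-+ m n o) ⟩
  (m + n) % o                 ∎
  where open ≡-Reasoning

[m+n%o]%o≡[m+n]%o : ∀ m n o .{{_ : NonZero o}} → (m + n % o) % o ≡ (m + n) % o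
[m+n%o]%o≡[m+n]%o m n o = trans (cong (_% o) (+-comm m (n % o))) (trans ([m%o+n]%o≡[m+n]%o n m o) (cong (_% o) (+-comm n m)))

module _ {P : ℕ → Set} (P? : ∀ i → Dec (P i)) where

  length-filter-upTo-suc : ∀ L → length (filter P? (upTo (suc L))) ≡ length (filter P? (upTo L)) + length (filter P? [ L ])
  length-filter-upTo-suc L = trans (cong (λ z → length (filter P? z)) (sym (upTo-∷ʳ L)))
                                   (trans (cong length (filter-++ P? (upTo L) [ L ])) (length-++ (filter P? (upTo L))))

  length-filter-upTo≡0 : ∀ L → (∀ {p} → p < L → ¬ P p) → length (filter P? (upTo L)) ≡ 0
  length-filter-upTo≡0 zero    _    = refl
  length-filter-upTo≡0 (suc L) none = trans (length-filter-upTo-suc L)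
    (cong₂ _+_ (length-filter-upTo≡0 L (none ∘ m<n⇒m<1+n)) (cong length (filter-reject P? {xs = []} (none ≤-refl))))

  length-filter-upTo≡1 : ∀ L {p₀} → p₀ < L → P p₀ → (∀ {p} → p < L → P p → p ≡ p₀) → length (filter P? (upTo L)) ≡ 1
  length-filter-upTo≡1 (suc L) p₀< Pp₀ only with m<1+n⇒m<n∨m≡n p₀<
  ... | inj₁ p₀<L = trans (length-filter-upTo-suc L)
    (cong₂ _+_ (length-filter-upTo≡1 L p₀<L Pp₀ (only ∘ m<n⇒m<1+n))
               (cong length (filter-reject P? {xs = []} λ PL → <-irrefl (sym (only ≤-refl PL)) p₀<L)))
  ... | inj₂ refl = trans (length-filter-upTo-suc L)
    (cong₂ _+_ (length-filter-upTo≡0 L λ p< Pp → <-irrefl (only (m<n⇒m<1+n p<) Pp) p<)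
               (cong length (filter-accept P? {xs = []} Pp₀)))

BlockAt : ℕ → Bits → Bits → ℕ → Set
BlockAt ℓ w x κ = κ * ℓ + ℓ ≤ length x × sub x (κ * ℓ) ℓ ≡ w

occb≡1 : ∀ {ℓ} w x → length w ≡ ℓ → 1 ≤ ℓ →
         ∀ κ₀ → BlockAt ℓ w x κ₀ → (∀ κ → BlockAt ℓ w x κ → κ ≡ κ₀) → occb w x ≡ 1
occb≡1 w x refl 1≤ℓ κ₀ (fits , block) only = length-filter-upTo≡1 _ (length x) start< start-ok unique
  where
  ℓ = length w
  ℓ′≡ℓ : suc (ℓ ∸ 1) ≡ ℓ
  ℓ′≡ℓ = m+[n∸m]≡n 1≤ℓ
  start< : κ₀ * ℓ < length x
  start< = <-≤-trans (m<m+n (κ₀ * ℓ) 1≤ℓ) fits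
  start-ok : (κ₀ * ℓ) % suc (ℓ ∸ 1) ≡ 0 × κ₀ * ℓ + ℓ ≤ length x × sub x (κ₀ * ℓ) ℓ ≡ w
  start-ok = trans (cong (λ z → (κ₀ * z) % suc (ℓ ∸ 1)) (sym ℓ′≡ℓ)) (m*n%n≡0 κ₀ (suc (ℓ ∸ 1))) , fits , block
  unique : ∀ {p} → p < length x → (p % suc (ℓ ∸ 1) ≡ 0 × p + ℓ ≤ length x × sub x p ℓ ≡ w) → p ≡ κ₀ * ℓ
  unique {p} _ (aligned , fits′ , block′) =
    trans p≡ (cong (_* ℓ) (only (p / suc (ℓ ∸ 1)) (subst (λ q → q + ℓ ≤ length x × sub x q ℓ ≡ w) p≡ (fits′ , block′))))
    where
    p≡ : p ≡ p / suc (ℓ ∸ 1) * ℓ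
    p≡ = trans (m≡m%n+[m/n]*n p (suc (ℓ ∸ 1))) (cong₂ (λ r L → r + p / suc (ℓ ∸ 1) * L) aligned ℓ′≡ℓ)

module DeBruijnBlocks (k : ℕ) where
  open Greedy k
  open Invariant y-invariant using (prefix-ones; window-injective)

  n N s t M L : ℕ
  n = suc k
  N = 2 ^ n
  s = val2 n
  t = oddPart n
  M = 2 ^ (n ∸ s)
  L = t * N

  2-adic : 2 ^ s * t ≡ n × t % 2 ≡ 1
  2-adic = split2-correct n n (s≤s z≤n) ≤-refl

  instance
    N-nonZero : NonZero N
    N-nonZero = m^n≢0 2 n
    t-nonZero : NonZero t
    t-nonZero = ≢-nonZero λ t≡0 → 0≢1+n (trans (sym (cong (_% 2) t≡0)) (proj₂ 2-adic))
    2^s-nonZero : NonZero (2 ^ s)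
    2^s-nonZero = m^n≢0 2 s
    M-nonZero : NonZero M
    M-nonZero = m^n≢0 2 (n ∸ s)
    2^s*M-nonZero : NonZero (2 ^ s * M)
    2^s*M-nonZero = m*n≢0 (2 ^ s) M
    n*M-nonZero : NonZero (n * M)
    n*M-nonZero = m*n≢0 n M
    L-nonZero : NonZero L
    L-nonZero = m*n≢0 t N

  2^s≤n : 2 ^ s ≤ n
  2^s≤n = subst (2 ^ s ≤_) (proj₁ 2-adic) (m≤m*n (2 ^ s) t)

  N≡2^s*M : N ≡ 2 ^ s * M
  N≡2^s*M = trans (cong (2 ^_) (sym (m+[n∸m]≡n s≤n))) (^-distribˡ-+-* 2 s (n ∸ s))
    where
    s≤n : s ≤ n
    s≤n = <⇒≤ (<-≤-trans (n<2^n s) 2^s≤n)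

  n*M≡L : n * M ≡ L
  n*M≡L = begin
    n * M               ≡⟨ cong (_* M) (sym (proj₁ 2-adic)) ⟩
    2 ^ s * t * M       ≡⟨ trans (*-assoc (2 ^ s) t M) (trans (cong (2 ^ s *_) (*-comm t M)) (sym (*-assoc (2 ^ s) M t))) ⟩
    2 ^ s * M * t       ≡⟨ *-comm (2 ^ s * M) t ⟩
    t * (2 ^ s * M)     ≡⟨ cong (t *_) (sym N≡2^s*M) ⟩
    L                   ∎
    where open ≡-Reasoning

  2^s*L≡N*n : 2 ^ s * L ≡ N * n
  2^s*L≡N*n = trans (sym (*-assoc (2 ^ s) t N)) (trans (cong (_* N) (proj₁ 2-adic)) (*-comm n N))

  k<N : k < N
  k<N = <-trans (n<1+n k) (n<2^n n)

  D : Bits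
  D = db n

  length-D : length D ≡ N
  length-D = trans (length-drop k y) windowCount≡2^

  length-dbShift : ∀ a → length (dbShift n a) ≡ N
  length-dbShift a = trans (length-rotate a D) length-D

  segment : ℕ → Bits
  segment a = pow (dbShift n a) t

  length-segment : ∀ a → length (segment a) ≡ L
  length-segment a = trans (length-pow (dbShift n a) t) (cong (t *_) (length-dbShift a))

  S≡concat : S n ≡ concat (applyUpTo segment (2 ^ s))
  S≡concat = cong concat (map-upTo segment (2 ^ s))

  length-S : length (S n) ≡ N * n
  length-S = trans (cong length S≡concat) (trans (length-concat-uniform (2 ^ s) segment L length-segment) 2^s*L≡N*n)

  at-S : ∀ p → p < 2 ^ s * L → at (S n) p ≡ at D ((p / L + p) % N)
  at-S p p< = begin
    at (S n) p                                 ≡⟨ cong (λ z → at z p) S≡concat ⟩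
    at (concat (applyUpTo segment (2 ^ s))) p    ≡⟨ at-concat-uniform (2 ^ s) segment L length-segment p p< ⟩
    at (segment a) (p % L)                       ≡⟨ at-pow (dbShift n a) t (length-dbShift a) (p % L) (m%n<n p L) ⟩
    at (dbShift n a) (p % L % N)               ≡⟨ at-rotate D length-D a (p % L % N) a≤N (m%n<n (p % L) N) ⟩
    at D ((a + p % L % N) % N)                 ≡⟨ cong (λ z → at D ((a + z) % N)) (m∣n⇒o%n%m≡o%m N L p (n∣m*n t)) ⟩
    at D ((a + p % N) % N)                     ≡⟨ cong (at D) ([m+n%o]%o≡[m+n]%o a p N) ⟩
    at D ((a + p) % N)                         ∎
    where
    open ≡-Reasoning
    a = p / L
    a≤N : a ≤ N
    a≤N = <⇒≤ (<-≤-trans (m<n*o⇒m/o<n p<) (≤-trans 2^s≤n (<⇒≤ (n<2^n n))))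

  -- Block κ of S, read cyclically in D, starts at offset κ.
  offset : ℕ → ℕ
  offset κ = κ / M + κ * n

  at-S-block : ∀ {κ r} → κ < N → r < n → at (S n) (κ * n + r) ≡ at D ((offset κ + r) % N)
  at-S-block {κ} {r} κ< r< = trans (at-S (κ * n + r) p<)
    (cong (λ z → at D (z % N)) (trans (cong (_+ (κ * n + r)) quotient) (sym (+-assoc (κ / M) (κ * n) r))))
    where
    p< : κ * n + r < 2 ^ s * L
    p< = subst (κ * n + r <_) (sym 2^s*L≡N*n) (<-≤-trans (+-monoʳ-< (κ * n) r<) (subst (_≤ N * n) (+-comm n (κ * n)) (*-monoˡ-≤ n κ<)))
    quotient : (κ * n + r) / L ≡ κ / M
    quotient = begin
      (κ * n + r) / L         ≡⟨ /-congʳ (sym n*M≡L) ⟩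
      (κ * n + r) / (n * M)   ≡⟨ sym (m/n/o≡m/[n*o] (κ * n + r) n M) ⟩
      (κ * n + r) / n / M     ≡⟨ cong (_/ M) (trans (+-distrib-/-∣ˡ r (n∣m*n κ)) (cong₂ _+_ (m*n/n≡m κ n) (m<n⇒m/n≡0 r<))) ⟩
      (κ + 0) / M             ≡⟨ cong (_/ M) (+-identityʳ κ) ⟩
      κ / M                   ∎
      where open ≡-Reasoning

  -- y = 1^k D and D ends in 1^k, so y is D read cyclically from position N - k.
  at-y : ∀ q → q < N + k → at y q ≡ at D ((q + (N ∸ k)) % N)
  at-y q q< with q <? k
  ... | yes q<k = begin
    at y q                           ≡⟨ prefix-ones q q<k ⟩
    true                             ≡⟨ sym (at-replicate k true q q<k) ⟩
    at (replicate k true) q          ≡⟨ cong (λ z → at z q) (sym lastNode-ones) ⟩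
    at (lastNode y) q                ≡⟨ at-drop y m q ⟩
    at y (m + q)                     ≡⟨ cong (at y) m+q≡ ⟩
    at y (k + (q + (N ∸ k)))         ≡⟨ sym (at-drop y k (q + (N ∸ k))) ⟩
    at D (q + (N ∸ k))               ≡⟨ cong (at D) (sym (m<n⇒m%n≡m (subst (q + (N ∸ k) <_) (m+[n∸m]≡n (<⇒≤ k<N)) (+-monoˡ-< (N ∸ k) q<k)))) ⟩
    at D ((q + (N ∸ k)) % N)         ∎
    where
    open ≡-Reasoning
    m+q≡ : m + q ≡ k + (q + (N ∸ k))
    m+q≡ = trans (cong (_+ q) (trans windowCount≡2^ (sym (m+[n∸m]≡n (<⇒≤ k<N)))))
                 (trans (+-assoc k (N ∸ k) q) (cong (k +_) (+-comm (N ∸ k) q)))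
  ... | no q≮k = begin
    at y q                           ≡⟨ cong (at y) (sym k+q′≡q) ⟩
    at y (k + q′)                    ≡⟨ sym (at-drop y k q′) ⟩
    at D q′                          ≡⟨ cong (at D) (sym (m<n⇒m%n≡m q′<N)) ⟩
    at D (q′ % N)                    ≡⟨ cong (at D) (sym ([m+n]%n≡m%n q′ N)) ⟩
    at D ((q′ + N) % N)              ≡⟨ cong (λ z → at D (z % N)) q′+N≡ ⟩
    at D ((q + (N ∸ k)) % N)         ∎
    where
    open ≡-Reasoning
    q′ = q ∸ k
    k+q′≡q : k + q′ ≡ q
    k+q′≡q = m+[n∸m]≡n (≮⇒≥ q≮k)
    q′<N : q′ < N
    q′<N = +-cancelˡ-< k q′ N (subst₂ _<_ (sym k+q′≡q) (+-comm N k) q<)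
    q′+N≡ : q′ + N ≡ q + (N ∸ k)
    q′+N≡ = trans (cong (q′ +_) (sym (m+[n∸m]≡n (<⇒≤ k<N))))
                  (trans (sym (+-assoc q′ k (N ∸ k))) (cong (_+ (N ∸ k)) (trans (+-comm q′ k) k+q′≡q)))

  position : ℕ → ℕ
  position κ = (offset κ + k) % N

  position<m : ∀ κ → position κ < m
  position<m κ = subst (position κ <_) (sym windowCount≡2^) (m%n<n (offset κ + k) N)

  at-window-position : ∀ κ {r} → r < n → at (window y (position κ)) r ≡ at D ((offset κ + r) % N)
  at-window-position κ {r} r< = begin
    at (window y (position κ)) r                  ≡⟨ at-sub y (position κ) n r r< ⟩
    at y (position κ + r)                         ≡⟨ at-y (position κ + r) (+-mono-<-≤ (m%n<n (offset κ + k) N) (≤-pred r<)) ⟩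
    at D ((position κ + r + (N ∸ k)) % N)         ≡⟨ cong (λ z → at D (z % N)) (+-assoc (position κ) r (N ∸ k)) ⟩
    at D ((position κ + (r + (N ∸ k))) % N)       ≡⟨ cong (at D) ([m%o+n]%o≡[m+n]%o (offset κ + k) (r + (N ∸ k)) N) ⟩
    at D ((offset κ + k + (r + (N ∸ k))) % N)     ≡⟨ cong (λ z → at D (z % N)) rearranged ⟩
    at D ((offset κ + r + N) % N)                 ≡⟨ cong (at D) ([m+n]%n≡m%n (offset κ + r) N) ⟩
    at D ((offset κ + r) % N)                     ∎
    where
    open ≡-Reasoning
    rearranged : offset κ + k + (r + (N ∸ k)) ≡ offset κ + r + N
    rearranged = trans (solve 4 (λ o k r c → o :+ k :+ (r :+ c) := o :+ r :+ (k :+ c)) refl (offset κ) k r (N ∸ k))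
                       (cong (offset κ + r +_) (m+[n∸m]≡n (<⇒≤ k<N)))

  block-fits : ∀ {κ} → κ < N → κ * n + n ≤ length (S n)
  block-fits {κ} κ< = subst (κ * n + n ≤_) (sym length-S) (subst (_≤ N * n) (+-comm n (κ * n)) (*-monoˡ-≤ n κ<))

  block≡window : ∀ {κ} → κ < N → sub (S n) (κ * n) n ≡ window y (position κ)
  block≡window {κ} κ< = at-ext _ _ (trans |block| (sym (length-window y (position<m κ)))) λ r r< →
    let r<n = subst (r <_) |block| r< in
    trans (at-sub (S n) (κ * n) n r r<n) (trans (at-S-block κ< r<n) (sym (at-window-position κ r<n)))
    where
    |block| : length (sub (S n) (κ * n) n) ≡ n
    |block| = length-sub (S n) (κ * n) n (block-fits κ<)

  position-injective : InjectiveBelow N position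
  position-injective {κ} {κ′} κ< κ′< eq = offset-injective (2 ^ s) (n ∸ s) t (proj₂ 2-adic)
    (subst (κ <_) N≡2^s*M κ<) (subst (κ′ <_) N≡2^s*M κ′<) (trans (sym (radix κ)) (trans offsets≡ (radix κ′)))
    where
    unshift : ∀ x → ((x + k) % N + (N ∸ k)) % N ≡ x % N
    unshift x = trans ([m%o+n]%o≡[m+n]%o (x + k) (N ∸ k) N)
                      (trans (cong (_% N) (trans (+-assoc x k (N ∸ k)) (cong (x +_) (m+[n∸m]≡n (<⇒≤ k<N))))) ([m+n]%n≡m%n x N))
    offsets≡ : offset κ % N ≡ offset κ′ % N
    offsets≡ = trans (sym (unshift (offset κ))) (trans (cong (λ z → (z + (N ∸ k)) % N) eq) (unshift (offset κ′)))
    radix : ∀ κ → offset κ % N ≡ (κ / M + κ * (2 ^ s * t)) % (2 ^ s * M)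
    radix κ = trans (%-congʳ N≡2^s*M) (cong (λ z → (κ / M + κ * z) % (2 ^ s * M)) (sym (proj₁ 2-adic)))

  block-unique : ∀ {w κ₀} → κ₀ < N → window y (position κ₀) ≡ w →
                 BlockAt n w (S n) κ₀ × (∀ κ → BlockAt n w (S n) κ → κ ≡ κ₀)
  block-unique {w} {κ₀} κ₀< window≡w = (block-fits κ₀< , trans (block≡window κ₀<) window≡w) , only
    where
    only : ∀ κ → BlockAt n w (S n) κ → κ ≡ κ₀
    only κ (fits , block≡w) = position-injective κ< κ₀< (window-injective (position<m κ) (position<m κ₀)
                                (trans (sym (block≡window κ<)) (trans block≡w (sym window≡w))))
      where
      κ< : κ < N
      κ< = *-cancelʳ-≤ (suc κ) N n (subst (_≤ N * n) (+-comm (κ * n) n) (subst (κ * n + n ≤_) length-S fits))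

  unique-block : ∀ w → length w ≡ n → ∃ λ κ₀ → BlockAt n w (S n) κ₀ × (∀ κ → BlockAt n w (S n) κ → κ ≡ κ₀)
  unique-block w |w| =
    let i , i< , window≡w = occurs-all w |w|
        κ₀ , κ₀< , position≡i = injectiveBelow⇒surjective position (λ {κ} _ → m%n<n (offset κ + k) N) refl
                                  position-injective (subst (i <_) windowCount≡2^ i<)
    in κ₀ , block-unique κ₀< (trans (cong (window y) position≡i) window≡w)

lemma1 : (n : ℕ) → n ≥ 1 → (w : Bits) → length w ≡ n → occb w (S n) ≡ 1
lemma1 zero    ()  w |w|
lemma1 (suc k) 1≤n w |w| =
  let κ₀ , at-κ₀ , only = DeBruijnBlocks.unique-block k w |w|
  in occb≡1 w (S (suc k)) |w| 1≤n κ₀ at-κ₀ only
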